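{- Let $h$ be a positive integer, $y\ge h$, and let $D$ be a positive integer that is $(1+1/h)$-dense in $[h,y]$. Let $k\ge 0$ and let $m_1,\dots,m_k$ be positive integers such that $m_j\le (y/h)\,m_1\cdots m_{j-1}$ for $1\le j\le k$. Then $m=Dm_1\cdots m_k$ is $(1+1/h)$-dense in $[h,\,m_1\cdots m_k\, y]$.
   Context: For real $u$ and a set $I$ of reals, an integer $n$ is said to be $u$-dense in $I$ if for every $y\in I$ the interval $(y,uy]$ contains a divisor of $n$. An empty product equals $1$.
   Formalization: The parameter y and the points of the set I in the definition of $u$-dense range over the rationals instead of the reals. -}

module Defs where

open import Data.Nat as ℕ using (ℕ; NonZero)
open import Data.Nat.Divisibility using (_∣_)
open import Data.Integer using (+_)
open import Data.Rational using (ℚ; _≤_; _<_; _*_; _+_; _/_; 1ℚ)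
open import Data.Product using (Σ; _×_)

⟦_⟧ : ℕ → ℚ
⟦ n ⟧ = + n / 1

u[_] : (h : ℕ) → .{{NonZero h}} → ℚ
u[ h ] = 1ℚ + (+ 1 / h)

Dense : ℚ → ℕ → ℚ → ℚ → Set
Dense u n lo hi =
  (t : ℚ) → lo ≤ t → t ≤ hi →
  Σ ℕ (λ d → d ∣ n × (t < ⟦ d ⟧ × ⟦ d ⟧ ≤ u * t))

-- Induction on k. The step: if n is u-dense in [lo, hi] and m·lo ≤ hi, then nm is u-dense in
-- [lo, m·hi]. For t ∈ [lo, m·hi] with t/m ≥ lo, a divisor of n in (t/m, u t/m] times m lies in
-- (t, u t]; otherwise t < m·lo ≤ hi, so a divisor of n already lies in (t, u t].
module Submission where

open import Defs
open import Data.Nat as ℕ using (ℕ; NonZero; suc)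
open import Data.Integer using (+_)
open import Data.Rational
  using (ℚ; mkℚ; _≤_; _<_; _*_; _/_; 1/_; 1ℚ; _≤?_; Positive)
open import Data.List using (List; lookup; take; []; _∷_)
open import Data.Nat.ListAction using (product)
open import Data.List.Relation.Unary.All using (All; []; _∷_)
import Data.List.Relation.Unary.All as All
open import Data.Fin using (toℕ; zero; suc)

import Data.Integer as ℤ
import Data.Integer.Properties as ℤ
import Data.Nat.Properties as ℕ
open import Data.Rational.Properties
  using ( normalize-coprime; normalize-pos; toℚᵘ-injective; toℚᵘ-homo-*; *-assoc; *-identityʳ
        ; *-inverseˡ; *-inverseʳ; *-monoˡ-<-pos; *-monoʳ-≤-nonNeg; *-cancelʳ-≤-pos
        ; *-identityˡ; *-comm; *-monoˡ-≤-nonNeg; ≤-trans; ≤-reflexive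
        ; pos⇒nonNeg; pos⇒nonZero; <⇒≤; <-≤-trans; ≰⇒> )
import Data.Rational.Unnormalised as ℚᵘ
import Data.Rational.Unnormalised.Properties as ℚᵘ
open import Data.Rational.Solver using (module +-*-Solver)
open import Data.Nat.Coprimality using (1-coprimeTo)
import Data.Nat.Coprimality as Coprime
open import Data.Nat.Divisibility using (_∣_; ∣-trans; m∣m*n; *-monoˡ-∣)
open import Data.Product using (Σ; _×_; _,_)
open import Relation.Binary.PropositionalEquality
open import Relation.Nullary using (Dec; yes; no)

-- ⟦ n ⟧ is normalize n 1, which is stuck for a variable n; ℕ→ℚ is its normal form, on which
-- multiplication can be computed.
ℕ→ℚ : ℕ → ℚ
ℕ→ℚ n = mkℚ (+ n) 0 (Coprime.sym (1-coprimeTo n))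

⟦⟧≡ℕ→ℚ : ∀ n → ⟦ n ⟧ ≡ ℕ→ℚ n
⟦⟧≡ℕ→ℚ n = normalize-coprime (Coprime.sym (1-coprimeTo n))

⟦⟧-homo-* : ∀ m n → ⟦ m ℕ.* n ⟧ ≡ ⟦ m ⟧ * ⟦ n ⟧
⟦⟧-homo-* m n rewrite ⟦⟧≡ℕ→ℚ (m ℕ.* n) | ⟦⟧≡ℕ→ℚ m | ⟦⟧≡ℕ→ℚ n =
  toℚᵘ-injective (ℚᵘ.≃-trans (ℚᵘ.*≡* (cong (ℤ._* + 1) (ℤ.pos-* m n)))
                              (ℚᵘ.≃-sym (toℚᵘ-homo-* (ℕ→ℚ m) (ℕ→ℚ n))))

*-⟦⟧-homo-* : ∀ x m n → x * ⟦ m ℕ.* n ⟧ ≡ (x * ⟦ m ⟧) * ⟦ n ⟧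
*-⟦⟧-homo-* x m n = trans (cong (x *_) (⟦⟧-homo-* m n)) (sym (*-assoc x ⟦ m ⟧ ⟦ n ⟧))

⟦⟧-*-1/-inverse : ∀ h .{{_ : NonZero h}} → ⟦ h ⟧ * (+ 1 / h) ≡ 1ℚ
⟦⟧-*-1/-inverse (suc h)
  rewrite ⟦⟧≡ℕ→ℚ (suc h) | normalize-coprime {1} {h} (1-coprimeTo (suc h)) =
  *-inverseʳ (ℕ→ℚ (suc h))

⟦⟧-positive : ∀ m .{{_ : NonZero m}} → Positive ⟦ m ⟧
⟦⟧-positive m = normalize-pos m 1

≤-*-1/⇒⟦⟧-*-≤ : ∀ h .{{_ : NonZero h}} {x y p} →
  x ≤ (y * (+ 1 / h)) * p → ⟦ h ⟧ * x ≤ y * p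
≤-*-1/⇒⟦⟧-*-≤ h {x} {y} {p} x≤yp/h =
  ≤-trans (*-monoˡ-≤-nonNeg ⟦ h ⟧ x≤yp/h) (≤-reflexive (begin
    ⟦ h ⟧ * ((y * (+ 1 / h)) * p) ≡⟨ regroup ⟦ h ⟧ y (+ 1 / h) p ⟩
    (⟦ h ⟧ * (+ 1 / h)) * (y * p) ≡⟨ cong (_* (y * p)) (⟦⟧-*-1/-inverse h) ⟩
    1ℚ * (y * p)                  ≡⟨ *-identityˡ (y * p) ⟩
    y * p                         ∎))
  where
  open ≡-Reasoning
  open +-*-Solver using (solve; _:*_; _:=_)
  instance _ = pos⇒nonNeg ⟦ h ⟧ {{⟦⟧-positive h}}
  regroup : ∀ a b c d → a * ((b * c) * d) ≡ (a * c) * (b * d)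
  regroup = solve 4 (λ a b c d → a :* ((b :* c) :* d) := (a :* c) :* (b :* d)) refl

HasDivisorIn : ℚ → ℕ → ℚ → Set
HasDivisorIn u n t = Σ ℕ (λ d → d ∣ n × (t < ⟦ d ⟧ × ⟦ d ⟧ ≤ u * t))

module _ (u : ℚ) where

  HasDivisorIn-∣ : ∀ {n n′ t} → n ∣ n′ → HasDivisorIn u n t → HasDivisorIn u n′ t
  HasDivisorIn-∣ n∣n′ (d , d∣n , t<d , d≤ut) = d , ∣-trans d∣n n∣n′ , t<d , d≤ut

  HasDivisorIn-* : ∀ {n t} m .{{_ : NonZero m}} →
    HasDivisorIn u n t → HasDivisorIn u (n ℕ.* m) (t * ⟦ m ⟧)
  HasDivisorIn-* {n} {t} m (d , d∣n , t<d , d≤ut) =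
    d ℕ.* m , *-monoˡ-∣ m d∣n , tm<dm , dm≤utm
    where
    instance _ = ⟦⟧-positive m
    tm<dm : t * ⟦ m ⟧ < ⟦ d ℕ.* m ⟧
    tm<dm = subst (t * ⟦ m ⟧ <_) (sym (⟦⟧-homo-* d m)) (*-monoˡ-<-pos ⟦ m ⟧ t<d)
    dm≤utm : ⟦ d ℕ.* m ⟧ ≤ u * (t * ⟦ m ⟧)
    dm≤utm = subst₂ _≤_ (sym (⟦⟧-homo-* d m)) (*-assoc u t ⟦ m ⟧)
               (*-monoʳ-≤-nonNeg ⟦ m ⟧ {{pos⇒nonNeg ⟦ m ⟧}} d≤ut)

  Dense-*-step : ∀ {n lo hi} m .{{_ : NonZero m}} → lo * ⟦ m ⟧ ≤ hi →
    Dense u n lo hi → Dense u (n ℕ.* m) lo (hi * ⟦ m ⟧)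
  Dense-*-step {n} {lo} {hi} m lom≤hi dense t lo≤t t≤hm = divisor (lo ≤? s)
    where
    instance _ = ⟦⟧-positive m
    instance _ = pos⇒nonZero ⟦ m ⟧
    s : ℚ
    s = t * 1/ ⟦ m ⟧
    sm≡t : s * ⟦ m ⟧ ≡ t
    sm≡t = begin
      t * 1/ ⟦ m ⟧ * ⟦ m ⟧   ≡⟨ *-assoc t (1/ ⟦ m ⟧) ⟦ m ⟧ ⟩
      t * (1/ ⟦ m ⟧ * ⟦ m ⟧) ≡⟨ cong (t *_) (*-inverseˡ ⟦ m ⟧) ⟩
      t * 1ℚ                 ≡⟨ *-identityʳ t ⟩
      t                      ∎
      where open ≡-Reasoning
    s≤hi : s ≤ hi
    s≤hi = *-cancelʳ-≤-pos ⟦ m ⟧ (subst (_≤ hi * ⟦ m ⟧) (sym sm≡t) t≤hm)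
    divisor : Dec (lo ≤ s) → HasDivisorIn u (n ℕ.* m) t
    divisor (yes lo≤s) =
      subst (HasDivisorIn u (n ℕ.* m)) sm≡t (HasDivisorIn-* m (dense s lo≤s s≤hi))
    divisor (no lo≰s) =
      HasDivisorIn-∣ (m∣m*n m) (dense t lo≤t (<⇒≤ (<-≤-trans t<lom lom≤hi)))
      where
      t<lom : t < lo * ⟦ m ⟧
      t<lom = subst (_< lo * ⟦ m ⟧) sm≡t (*-monoˡ-<-pos ⟦ m ⟧ (≰⇒> lo≰s))

  Dense-*-product : ∀ {n lo hi} (ms : List ℕ) → All NonZero ms →
    (∀ j → lo * ⟦ lookup ms j ⟧ ≤ hi * ⟦ product (take (toℕ j) ms) ⟧) →
    Dense u n lo hi → Dense u (n ℕ.* product ms) lo (hi * ⟦ product ms ⟧)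
  Dense-*-product {n} {lo} {hi} [] [] _ dense =
    subst₂ (λ n′ hi′ → Dense u n′ lo hi′) (sym (ℕ.*-identityʳ n)) (sym (*-identityʳ hi)) dense
  Dense-*-product {n} {lo} {hi} (m ∷ ms) (m≢0 ∷ ms≢0) bounds dense =
    subst₂ (λ n′ hi′ → Dense u n′ lo hi′)
      (ℕ.*-assoc n m (product ms)) (sym (*-⟦⟧-homo-* hi m (product ms)))
      (Dense-*-product ms ms≢0 bounds′ (Dense-*-step m {{m≢0}} bound₀ dense))
    where
    bound₀ : lo * ⟦ m ⟧ ≤ hi
    bound₀ = subst (lo * ⟦ m ⟧ ≤_) (*-identityʳ hi) (bounds zero)
    bounds′ : ∀ j → lo * ⟦ lookup ms j ⟧ ≤ (hi * ⟦ m ⟧) * ⟦ product (take (toℕ j) ms) ⟧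
    bounds′ j = subst (lo * ⟦ lookup ms j ⟧ ≤_) (*-⟦⟧-homo-* hi m _) (bounds (suc j))

lemma8 : (h : ℕ) → .{{_ : NonZero h}} → (y : ℚ) → ⟦ h ⟧ ≤ y →
    (D : ℕ) → 1 ℕ.≤ D → Dense u[ h ] D ⟦ h ⟧ y →
    (ms : List ℕ) → All (λ m → 1 ℕ.≤ m) ms →
    (∀ j → ⟦ lookup ms j ⟧ ≤ (y * (+ 1 / h)) * ⟦ product (take (toℕ j) ms) ⟧) →
    Dense u[ h ] (D ℕ.* product ms) ⟦ h ⟧ (⟦ product ms ⟧ * y)
lemma8 h y _ D _ dense ms ms≥1 bounds =
  subst (Dense u[ h ] (D ℕ.* product ms) ⟦ h ⟧) (*-comm y ⟦ product ms ⟧)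
    (Dense-*-product u[ h ] ms (All.map ℕ.>-nonZero ms≥1)
      (λ j → ≤-*-1/⇒⟦⟧-*-≤ h {y = y} (bounds j)) dense)
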